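{- The $\mathbb{Q}[\mu]$-submodule $\mathbb{Q}[\mu]\langle Y\rangle^0$ is closed under $\ast_\mu$, i.e. $(\mathbb{Q}[\mu]\langle Y\rangle^0,\ast_\mu)$ is a subalgebra of $(\mathbb{Q}[\mu]\langle Y\rangle,\ast_\mu)$.
   Context: Fix $\mu\in\mathbb{C}$, $\mathrm{Re}(\mu)>0$; $\mathbb{Q}[\mu]\subset\mathbb{C}$ the ring generated by $\mu$. $Y=\{y_{k,m}:k\in\mathbb{N},m\in\mathbb{Q}_{>0}\}$, $\mathbb{Q}[\mu]\langle Y\rangle$ the free $\mathbb{Q}[\mu]$-module on words over $Y$ with concatenation; $y_{\mathbf{k};\mathbf{m}}=y_{k_1,m_1}\cdots y_{k_r,m_r}$. $\odot$ on letters: $y_{k_1,m}\odot y_{k_2,m}=y_{k_1+k_2,m}$; for $m_1\ne m_2$, $y_{k_1,m_1}\odot y_{k_2,m_2}=\sum_{i\le k_1}a_iy_{i,m_1}+\sum_{j\le k_2}b_jy_{j,m_2}$ with $\frac{1}{(x+m_1)^{k_1}(x+m_2)^{k_2}}=\sum\frac{a_i}{(x+m_1)^i}+\sum\frac{b_j}{(x+m_2)^j}$. $\ast_\mu$: bilinear, $1\ast_\mu w=w\ast_\mu1=w$, $ux\ast_\mu vy=(u\ast_\mu vy)x+(ux\ast_\mu v)y-\mu(u\ast_\mu v)(x\odot y)$ for letters $x,y$. A word $y_{\mathbf{k};\mathbf{m}}$ is admissible if $k_r>1$ (the empty word $1$ is admissible). For $\mathbf{k}=(k_1,\dots,k_{r-1},1)$,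 $\mathbf{m}=(m_1,\dots,m_r)$, $\tilde{\mathbf{m}}=(m_1,\dots,m_{r-1},\tilde m_r)$ with $\tilde m_r\ne m_r$ (all in $\mathbb{Q}_{>0}$), the element $y_{\mathbf{k};\mathbf{m}}-y_{\mathbf{k};\tilde{\mathbf{m}}}=y_{k_1,m_1}\cdots y_{k_{r-1},m_{r-1}}(y_{1,m_r}-y_{1,\tilde m_r})$ is quasi-admissible. $\mathbb{Q}[\mu]\langle Y\rangle^0$ is the $\mathbb{Q}[\mu]$-span of admissible words and quasi-admissible elements. -}

module Defs where

open import Level using (Level)
open import Data.Nat as ℕ using (ℕ; zero; suc; _≤_) renaming (_+_ to _+ℕ_)
open import Data.Nat.Properties using (≤-trans; m≤m+n) renaming (_≟_ to _≟ℕ_)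
open import Data.Rational as ℚ using (ℚ; 0ℚ; 1ℚ; _-_; 1/_; ≢-nonZero) renaming (_<_ to _<ℚ_; _*_ to _*ℚ_; -_ to -ℚ_)
open import Data.Rational.Properties using () renaming (_≟_ to _≟ℚ_)
open import Data.List using (List; []; _∷_; _++_; map; concatMap; foldr)
open import Data.Product using (_×_; _,_; Σ)
open import Data.Unit using (⊤)
open import Relation.Nullary using (Dec; yes; no; ¬_)
open import Relation.Binary.PropositionalEquality using (_≡_; _≢_; refl; cong)
open import Algebra.Bundles using (CommutativeRing)

-- Letters y_{k,m} with k ∈ ℕ, k ≥ 1, and m ∈ ℚ_{>0}.
-- (The positivity proofs are irrelevant fields, so a letter is determined
-- by the pair (k , m).)

record Letter : Set where
  constructor y
  field
    k    : ℕ
    m    : ℚ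
    .k≥1 : 1 ≤ k
    .m>0 : 0ℚ <ℚ m
open Letter public

_≟L_ : (l₁ l₂ : Letter) → Dec (l₁ ≡ l₂)
y k₁ m₁ _ _ ≟L y k₂ m₂ _ _ with k₁ ≟ℕ k₂ | m₁ ≟ℚ m₂
... | yes refl | yes refl = yes refl
... | no k≢    | _        = no λ eq → k≢ (cong Letter.k eq)
... | yes _    | no m≢    = no λ eq → m≢ (cong Letter.m eq)

-- A word  y_{k₁,m₁} ⋯ y_{k_r,m_r}  is written
-- ((([] ▷ y_{k₁,m₁}) ▷ y_{k₂,m₂}) ⋯ ▷ y_{k_r,m_r}); the empty word [] is 1,
-- and  w ▷ x  is the concatenation  w x  with a letter x on the right.

infixl 5 _▷_
data Word : Set where
  []  : Word
  _▷_ : Word → Letter → Word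

_≟W_ : (w₁ w₂ : Word) → Dec (w₁ ≡ w₂)
[]       ≟W []       = yes refl
[]       ≟W (_ ▷ _)  = no λ ()
(_ ▷ _)  ≟W []       = no λ ()
(u ▷ x)  ≟W (v ▷ z) with u ≟W v | x ≟L z
... | yes refl | yes refl = yes refl
... | no u≢    | _        = no λ { refl → u≢ refl }
... | yes _    | no x≢    = no λ { refl → x≢ refl }

Admissible : Word → Set
Admissible []      = ⊤
Admissible (w ▷ l) = 2 ≤ k l

-- total inverse on ℚ (only ever applied to nonzero arguments below)
inv : ℚ → ℚ
inv p with p ≟ℚ 0ℚ
... | yes _  = 0ℚ
... | no p≢0 = 1/_ p {{≢-nonZero p≢0}}

LComb : Set
LComb = List (ℚ × Letter)

scaleℚ : ℚ → LComb → LComb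
scaleℚ r = map (λ { (q , l) → (r *ℚ q , l) })

-- Partial fractions: pf a b p q  is the decomposition of
--   1 / ((x+a)^p (x+b)^q)   (a ≠ b, p + q ≥ 1)
-- as  Σ_i a_i/(x+a)^i + Σ_j b_j/(x+b)^j , with 1/(x+a)^i encoded by the
-- letter y_{i,a}.  It is computed by the partial-fraction recursion
--   1/((x+a)^p(x+b)^q) = 1/(b-a) · ( 1/((x+a)^p(x+b)^(q-1)) - 1/((x+a)^(p-1)(x+b)^q) ),
-- which is the identity 1/((x+a)(x+b)) = 1/(b-a) · (1/(x+a) - 1/(x+b)).
pf : (a b : ℚ) → .(0ℚ <ℚ a) → .(0ℚ <ℚ b) → ℕ → ℕ → LComb
pf a b pa pb zero    zero    = []
pf a b pa pb (suc p) zero    = (1ℚ , y (suc p) a (ℕ.s≤s ℕ.z≤n) pa) ∷ []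
pf a b pa pb zero    (suc q) = (1ℚ , y (suc q) b (ℕ.s≤s ℕ.z≤n) pb) ∷ []
pf a b pa pb (suc p) (suc q) =
  scaleℚ (inv (b - a)) (pf a b pa pb (suc p) q ++ scaleℚ (-ℚ 1ℚ) (pf a b pa pb p (suc q)))

_⊙_ : Letter → Letter → LComb
y k₁ m₁ p₁ q₁ ⊙ y k₂ m₂ p₂ q₂ with m₁ ≟ℚ m₂
... | yes _ = (1ℚ , y (k₁ +ℕ k₂) m₁ (≤-trans p₁ (m≤m+n k₁ k₂)) q₁) ∷ []
... | no  _ = pf m₁ m₂ q₁ q₂ k₁ k₂

module FreeModule {c ℓ : Level} (R : CommutativeRing c ℓ) where
  open CommutativeRing R

  Poly : Set c
  Poly = List (Carrier × Word)

  coeff : Poly → Word → Carrier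
  coeff []             w = 0#
  coeff ((a , v) ∷ p)  w with v ≟W w
  ... | yes _ = a + coeff p w
  ... | no  _ = coeff p w

  _≋_ : Poly → Poly → Set ℓ
  p ≋ q = ∀ w → coeff p w ≈ coeff q w

  scale : Carrier → Poly → Poly
  scale r = map (λ { (a , w) → (r * a , w) })

  data Gen : Set where
    adm  : (w : Word) → Admissible w → Gen
    qadm : (w : Word) (l₁ l₂ : Letter) → k l₁ ≡ 1 → k l₂ ≡ 1 → m l₁ ≢ m l₂ → Gen

  ⟦_⟧ : Gen → Poly
  ⟦ adm w _ ⟧             = (1# , w) ∷ []
  ⟦ qadm w l₁ l₂ _ _ _ ⟧  = (1# , w ▷ l₁) ∷ (- 1# , w ▷ l₂) ∷ []

  lin : List (Carrier × Gen) → Poly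
  lin = concatMap (λ { (r , g) → scale r ⟦ g ⟧ })

  InY⁰ : Poly → Set (c Level.⊔ ℓ)
  InY⁰ p = Σ (List (Carrier × Gen)) λ gs → p ≋ lin gs

  -- The product ∗_μ, for a ring map ι : ℚ → R (used to read the
  -- rational coefficients of ⊙ in R) and a parameter μ ∈ R.

  module Star (ι : ℚ → Carrier) (μ : Carrier) where

    appendL : Poly → Letter → Poly
    appendL p x = map (λ { (a , w) → (a , w ▷ x) }) p

    μmul : Poly → LComb → Poly
    μmul p l = concatMap (λ { (a , w) → map (λ { (q , z) → (- (μ * (a * ι q)) , w ▷ z) }) l }) p

    _∗w_ : Word → Word → Poly
    []      ∗w w       = (1# , w) ∷ []
    (u ▷ x) ∗w []      = (1# , u ▷ x) ∷ []
    (u ▷ x) ∗w (v ▷ z) =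
      appendL (u ∗w (v ▷ z)) x ++ appendL ((u ▷ x) ∗w v) z ++ μmul (u ∗w v) (x ⊙ z)

    _∗_ : Poly → Poly → Poly
    p ∗ q = concatMap (λ { (a , u) → concatMap (λ { (b , v) → scale (a * b) (u ∗w v) }) q }) p

-- ∗_μ is bilinear, so it suffices to multiply generators.  Apart from the empty word,
-- which is the unit of ∗_μ, a generator is a word w followed by an ending: an admissible
-- letter, or a difference y_{1,m} − y_{1,m̃}.  In the recursion
--   ux ∗ vz = (u ∗ vz) x + (ux ∗ v) z − μ (u ∗ v)(x ⊙ z)
-- the first term ends in x and the second in z, so letting each ending act on its own letter
-- keeps these terms in Y⁰ whatever the other ending does.  The μ-term lies in Y⁰ because,
-- by partial fractions, x ⊙ z is a combination of admissible letters and a multiple of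
-- y_{1,m₁} − y_{1,m₂}: the residues of 1/((t+m₁)^k₁ (t+m₂)^k₂) at −m₁ and −m₂ cancel.

module Submission where

open import Defs
open import Level using (Level; _⊔_)
open import Data.Rational using (ℚ; 0ℚ; 1ℚ) renaming (_*_ to _*ℚ_; -_ to -ℚ_; _-_ to _-ℚ_; _<_ to _<ℚ_)
open import Data.Rational.Properties using (+-*-commutativeRing) renaming (_≟_ to _≟ℚ_)
open import Algebra.Bundles using (CommutativeRing; CommutativeMonoid)
open import Algebra.Structures using (IsCommutativeMonoid)
open import Algebra.Morphism.Structures using (module RingMorphisms)
import Algebra.Properties.CommutativeSemigroup as CommutativeSemigroupProperties
open import Data.List using (List; []; _∷_; _++_; map; concatMap; filter; length)
open import Data.List.Properties using (map-++; map-∘; ++-assoc; ++-identityʳ; concatMap-++; length-filter)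
open import Data.Product using (_×_; _,_)
open import Data.Nat using (zero; suc; _≤_; z≤n; s≤s)
open import Data.Nat.Properties using (≤-trans; ≤-refl; n≮0; m≤n+m)
open import Data.Empty.Irrelevant using (⊥-elim)
open import Relation.Nullary using (yes; no; ¬?; contradiction)
open import Relation.Binary.PropositionalEquality as ≡ using (_≡_; _≢_)

module Polynomials {c ℓ : Level} (R : CommutativeRing c ℓ) where
  open CommutativeRing R hiding (zero)
  open FreeModule R
  open CommutativeSemigroupProperties (CommutativeMonoid.commutativeSemigroup +-commutativeMonoid)
    using () renaming (interchange to +-interchange; x∙yz≈y∙xz to +-exchange)
  open import Algebra.Properties.Ring ring using (-1*x≈-x; -‿distribˡ-*; -‿distribʳ-*)
  open import Algebra.Properties.Group +-group using (x∙y⁻¹≈ε⇒x≈y; x≈y⇒x∙y⁻¹≈ε)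

  -- _≋_ wrapped in a record, so that the two polynomials can be inferred from an equation.
  infix 4 _≃_
  record _≃_ (p q : Poly) : Set ℓ where
    constructor coeffwise
    field coeff-≈ : p ≋ q
  open _≃_ public

  ≃-refl : ∀ {p} → p ≃ p
  ≃-refl = coeffwise λ _ → refl

  ≃-sym : ∀ {p q} → p ≃ q → q ≃ p
  ≃-sym (coeffwise e) = coeffwise λ w → sym (e w)

  ≃-trans : ∀ {p q r} → p ≃ q → q ≃ r → p ≃ r
  ≃-trans (coeffwise e) (coeffwise f) = coeffwise λ w → trans (e w) (f w)

  ≡⇒≃ : ∀ {p q} → p ≡ q → p ≃ q
  ≡⇒≃ ≡.refl = ≃-refl

  coeff-++ : ∀ p q w → coeff (p ++ q) w ≈ coeff p w + coeff q w
  coeff-++ []            q w = sym (+-identityˡ _)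
  coeff-++ ((a , v) ∷ p) q w with v ≟W w
  ... | yes _ = trans (+-congˡ (coeff-++ p q w)) (sym (+-assoc _ _ _))
  ... | no  _ = coeff-++ p q w

  coeff-scale : ∀ r p w → coeff (scale r p) w ≈ r * coeff p w
  coeff-scale r []            w = sym (zeroʳ r)
  coeff-scale r ((a , v) ∷ p) w with v ≟W w
  ... | yes _ = trans (+-congˡ (coeff-scale r p w)) (sym (distribˡ r _ _))
  ... | no  _ = coeff-scale r p w

  ∷-cong : ∀ {a b} v {p q} → a ≈ b → p ≃ q → (a , v) ∷ p ≃ (b , v) ∷ q
  ∷-cong {a} {b} v {p} {q} a≈b (coeffwise e) = coeffwise go
    where
    go : ∀ w → coeff ((a , v) ∷ p) w ≈ coeff ((b , v) ∷ q) w
    go w with v ≟W w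
    ... | yes _ = +-cong a≈b (e w)
    ... | no  _ = e w

  ++-cong : ∀ {p p′ q q′} → p ≃ p′ → q ≃ q′ → p ++ q ≃ p′ ++ q′
  ++-cong {p} {p′} {q} {q′} (coeffwise e) (coeffwise f) = coeffwise λ w →
    trans (coeff-++ p q w) (trans (+-cong (e w) (f w)) (sym (coeff-++ p′ q′ w)))

  scale-cong : ∀ r {p q} → p ≃ q → scale r p ≃ scale r q
  scale-cong r {p} {q} (coeffwise e) = coeffwise λ w →
    trans (coeff-scale r p w) (trans (*-congˡ (e w)) (sym (coeff-scale r q w)))

  scale-scale : ∀ r s p → scale r (scale s p) ≃ scale (r * s) p
  scale-scale r s p = coeffwise λ w → begin
    coeff (scale r (scale s p)) w  ≈⟨ coeff-scale r (scale s p) w ⟩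
    r * coeff (scale s p) w        ≈⟨ *-congˡ (coeff-scale s p w) ⟩
    r * (s * coeff p w)            ≈⟨ *-assoc r s _ ⟨
    r * s * coeff p w              ≈⟨ coeff-scale (r * s) p w ⟨
    coeff (scale (r * s) p) w      ∎
    where open import Relation.Binary.Reasoning.Setoid setoid

  scale-identity : ∀ p → scale 1# p ≃ p
  scale-identity p = coeffwise λ w → trans (coeff-scale 1# p w) (*-identityˡ _)

  ++-isCommutativeMonoid : IsCommutativeMonoid _≃_ _++_ []
  ++-isCommutativeMonoid = record
    { isMonoid = record
      { isSemigroup = record
        { isMagma = record
          { isEquivalence = record { refl = ≃-refl ; sym = ≃-sym ; trans = ≃-trans }
          ; ∙-cong = ++-cong
          }
        ; assoc = λ p q r → ≡⇒≃ (++-assoc p q r)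
        }
      ; identity = (λ _ → ≃-refl) , (λ p → ≡⇒≃ (++-identityʳ p))
      }
    ; comm = λ p q → coeffwise λ w →
        trans (coeff-++ p q w) (trans (+-comm _ _) (sym (coeff-++ q p w)))
    }

  ++-commutativeMonoid : CommutativeMonoid c ℓ
  ++-commutativeMonoid = record { isCommutativeMonoid = ++-isCommutativeMonoid }

  open CommutativeSemigroupProperties (CommutativeMonoid.commutativeSemigroup ++-commutativeMonoid)
    using (interchange)

  neg : Poly → Poly
  neg = scale (- 1#)

  infixl 6 _⊖_
  _⊖_ : Poly → Poly → Poly
  p ⊖ q = p ++ neg q

  neg-++ : ∀ p q → neg (p ++ q) ≡ neg p ++ neg q
  neg-++ = map-++ _

  -- InY⁰ wrapped in a record for the same reason.
  record Y⁰ (p : Poly) : Set (c ⊔ ℓ) where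
    constructor inY⁰
    field membership : InY⁰ p
  open Y⁰ public

  Y⁰-resp-≃ : ∀ {p} q → p ≃ q → Y⁰ q → Y⁰ p
  Y⁰-resp-≃ q (coeffwise e) (inY⁰ (gs , f)) = inY⁰ (gs , λ w → trans (e w) (f w))

  Y⁰-[] : Y⁰ []
  Y⁰-[] = inY⁰ ([] , λ _ → refl)

  Y⁰-++ : ∀ {p q} → Y⁰ p → Y⁰ q → Y⁰ (p ++ q)
  Y⁰-++ {p} {q} (inY⁰ (gs , e)) (inY⁰ (hs , f)) = inY⁰ (gs ++ hs ,
    coeff-≈ (≃-trans (++-cong {p} {lin gs} {q} {lin hs} (coeffwise e) (coeffwise f))
                     (≡⇒≃ (≡.sym (concatMap-++ _ gs hs)))))

  scaleGens : Carrier → List (Carrier × Gen) → List (Carrier × Gen)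
  scaleGens r = map (λ (s , g) → (r * s , g))

  lin-scale : ∀ r gs → scale r (lin gs) ≃ lin (scaleGens r gs)
  lin-scale r []             = ≃-refl
  lin-scale r ((s , g) ∷ gs) =
    ≃-trans (≡⇒≃ (map-++ _ (scale s ⟦ g ⟧) (lin gs)))
            (++-cong (scale-scale r s ⟦ g ⟧) (lin-scale r gs))

  Y⁰-scale : ∀ r {p} → Y⁰ p → Y⁰ (scale r p)
  Y⁰-scale r {p} (inY⁰ (gs , e)) =
    inY⁰ (scaleGens r gs , coeff-≈ (≃-trans (scale-cong r {p} {lin gs} (coeffwise e)) (lin-scale r gs)))

  Y⁰-⊖ : ∀ {p q} → Y⁰ p → Y⁰ q → Y⁰ (p ⊖ q)
  Y⁰-⊖ p∈ q∈ = Y⁰-++ p∈ (Y⁰-scale (- 1#) q∈)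

  Y⁰-⟦⟧ : ∀ g → Y⁰ ⟦ g ⟧
  Y⁰-⟦⟧ g = inY⁰ ((1# , g) ∷ [] ,
    coeff-≈ (≃-sym (≃-trans (≡⇒≃ (++-identityʳ _)) (scale-identity ⟦ g ⟧))))

  Y⁰-∷-admissible : ∀ a v → Admissible v → ∀ {p} → Y⁰ p → Y⁰ ((a , v) ∷ p)
  Y⁰-∷-admissible a v v-adm p∈ =
    Y⁰-resp-≃ (scale a ⟦ adm v v-adm ⟧ ++ _) (∷-cong v (sym (*-identityʳ a)) ≃-refl)
              (Y⁰-++ (Y⁰-scale a (Y⁰-⟦⟧ (adm v v-adm))) p∈)

  coeff-concatMap-∷ : ∀ {a} {A : Set a} (f : A → Poly) x xs w →
    coeff (concatMap f (x ∷ xs)) w ≈ coeff (concatMap f (x ∷ [])) w + coeff (concatMap f xs) w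
  coeff-concatMap-∷ f x xs w =
    trans (coeff-++ (f x) _ w) (+-congʳ (reflexive (≡.cong (λ r → coeff r w) (≡.sym (++-identityʳ (f x))))))

  ev : (Word → Carrier) → Poly → Carrier
  ev f []            = 0#
  ev f ((a , v) ∷ p) = a * f v + ev f p

  ev-++ : ∀ f p q → ev f (p ++ q) ≈ ev f p + ev f q
  ev-++ f []            q = sym (+-identityˡ _)
  ev-++ f ((a , v) ∷ p) q = trans (+-congˡ (ev-++ f p q)) (sym (+-assoc _ _ _))

  ev-scale : ∀ f r p → ev f (scale r p) ≈ r * ev f p
  ev-scale f r []            = sym (zeroʳ r)
  ev-scale f r ((a , v) ∷ p) = trans (+-cong (*-assoc r a _) (ev-scale f r p)) (sym (distribˡ r _ _))

  ev-cong : ∀ {f g} → (∀ v → f v ≈ g v) → ∀ p → ev f p ≈ ev g p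
  ev-cong f≈g []            = refl
  ev-cong f≈g ((a , v) ∷ p) = +-cong (*-congˡ (f≈g v)) (ev-cong f≈g p)

  ev-+ : ∀ f g p → ev (λ v → f v + g v) p ≈ ev f p + ev g p
  ev-+ f g []            = sym (+-identityˡ _)
  ev-+ f g ((a , v) ∷ p) =
    trans (+-cong (distribˡ a _ _) (ev-+ f g p)) (+-interchange _ _ _ _)

  ev-* : ∀ f r p → ev (λ v → r * f v) p ≈ r * ev f p
  ev-* f r []            = sym (zeroʳ r)
  ev-* f r ((a , v) ∷ p) =
    trans (+-cong (x∙yz≈y∙xz a r (f v)) (ev-* f r p)) (sym (distribˡ r _ _))
    where open CommutativeSemigroupProperties (CommutativeMonoid.commutativeSemigroup *-commutativeMonoid)

  ev-0 : ∀ p → ev (λ _ → 0#) p ≈ 0#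
  ev-0 []            = refl
  ev-0 ((a , v) ∷ p) = trans (+-cong (zeroʳ a) (ev-0 p)) (+-identityˡ 0#)

  ev-monomials : ∀ p w → ev (λ v → coeff ((1# , v) ∷ []) w) p ≈ coeff p w
  ev-monomials []            w = refl
  ev-monomials ((a , v) ∷ p) w with v ≟W w
  ... | yes _ = +-cong (trans (*-congˡ (+-identityʳ 1#)) (*-identityʳ a)) (ev-monomials p w)
  ... | no  _ = trans (+-congʳ (zeroʳ a)) (trans (+-identityˡ _) (ev-monomials p w))

  remove : Word → Poly → Poly
  remove u = filter λ (_ , v) → ¬? (v ≟W u)

  ev-remove : ∀ f u p → ev f p ≈ coeff p u * f u + ev f (remove u p)
  ev-remove f u []            = sym (trans (+-congʳ (zeroˡ (f u))) (+-identityˡ 0#))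
  ev-remove f u ((a , v) ∷ p) with v ≟W u
  ... | yes ≡.refl = trans (+-congˡ (ev-remove f v p))
                           (trans (sym (+-assoc _ _ _)) (+-congʳ (sym (distribʳ (f v) a _))))
  ... | no  _      = trans (+-congˡ (ev-remove f u p)) (+-exchange _ _ _)

  coeff-remove-self : ∀ u p → coeff (remove u p) u ≈ 0#
  coeff-remove-self u []            = refl
  coeff-remove-self u ((a , v) ∷ p) with v ≟W u
  ... | yes _  = coeff-remove-self u p
  ... | no v≢u with v ≟W u
  ...   | yes v≡u = contradiction v≡u v≢u
  ...   | no  _   = coeff-remove-self u p

  coeff-remove-other : ∀ {u w} → u ≢ w → ∀ p → coeff (remove u p) w ≈ coeff p w
  coeff-remove-other u≢w []            = refl
  coeff-remove-other {u} {w} u≢w ((a , v) ∷ p) with v ≟W u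
  ... | yes ≡.refl with v ≟W w
  ...   | yes ≡.refl = contradiction ≡.refl u≢w
  ...   | no  _      = coeff-remove-other u≢w p
  coeff-remove-other {u} {w} u≢w ((a , v) ∷ p) | no _ with v ≟W w
  ...   | yes _ = +-congˡ (coeff-remove-other u≢w p)
  ...   | no  _ = coeff-remove-other u≢w p

  remove-head : ∀ a u p → remove u ((a , u) ∷ p) ≡ remove u p
  remove-head a u p with u ≟W u
  ... | yes _   = ≡.refl
  ... | no  u≢u = contradiction ≡.refl u≢u

  ev-zero : ∀ f n p → length p ≤ n → (∀ w → coeff p w ≈ 0#) → ev f p ≈ 0#
  ev-zero f n       []            _         _   = refl
  ev-zero f (suc n) ((a , u) ∷ p) (s≤s |p|≤n) p≈0 = begin
    ev f ((a , u) ∷ p)                       ≈⟨ ev-remove f u ((a , u) ∷ p) ⟩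
    cᵤ * f u + ev f (remove u ((a , u) ∷ p)) ≡⟨ ≡.cong (λ r → cᵤ * f u + ev f r) (remove-head a u p) ⟩
    cᵤ * f u + ev f (remove u p)             ≈⟨ +-cong (trans (*-congʳ (p≈0 u)) (zeroˡ _)) rest≈0 ⟩
    0# + 0#                                  ≈⟨ +-identityˡ 0# ⟩
    0#                                       ∎
    where
    open import Relation.Binary.Reasoning.Setoid setoid
    cᵤ : Carrier
    cᵤ = coeff ((a , u) ∷ p) u
    remainder≈0 : ∀ w → coeff (remove u p) w ≈ 0#
    remainder≈0 w with u ≟W w
    ... | yes ≡.refl = coeff-remove-self u p
    ... | no  u≢w    = trans (reflexive (≡.cong (λ r → coeff r w) (≡.sym (remove-head a u p))))
                             (trans (coeff-remove-other u≢w ((a , u) ∷ p)) (p≈0 w))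
    rest≈0 : ev f (remove u p) ≈ 0#
    rest≈0 = ev-zero f n (remove u p) (≤-trans (length-filter _ p) |p|≤n) remainder≈0

  ev-resp-≃ : ∀ f {p q} → p ≃ q → ev f p ≈ ev f q
  ev-resp-≃ f {p} {q} (coeffwise e) = x∙y⁻¹≈ε⇒x≈y _ _ (begin
    ev f p - ev f q          ≈⟨ +-congˡ (-1*x≈-x _) ⟨
    ev f p + - 1# * ev f q   ≈⟨ +-congˡ (ev-scale f (- 1#) q) ⟨
    ev f p + ev f (neg q)    ≈⟨ ev-++ f p (neg q) ⟨
    ev f (p ⊖ q)             ≈⟨ ev-zero f _ (p ⊖ q) ≤-refl p⊖q≈0 ⟩
    0#                       ∎)
    where
    open import Relation.Binary.Reasoning.Setoid setoid
    p⊖q≈0 : ∀ w → coeff (p ⊖ q) w ≈ 0#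
    p⊖q≈0 w = trans (coeff-++ p (neg q) w)
                (trans (+-congˡ (trans (coeff-scale (- 1#) q w) (-1*x≈-x _))) (x≈y⇒x∙y⁻¹≈ε (e w)))

  data Ending : Set where
    admissible : (x : Letter) → 2 ≤ k x → Ending
    quasi      : (x₁ x₂ : Letter) → k x₁ ≡ 1 → k x₂ ≡ 1 → m x₁ ≢ m x₂ → Ending

  ⟪_⟫ : Ending → (Letter → Poly) → Poly
  ⟪ admissible x _ ⟫     f = f x
  ⟪ quasi x₁ x₂ _ _ _ ⟫ f = f x₁ ⊖ f x₂

  ⟪⟫-cong : ∀ E {f g} → (∀ x → f x ≃ g x) → ⟪ E ⟫ f ≃ ⟪ E ⟫ g
  ⟪⟫-cong (admissible x _)     f≃g = f≃g x
  ⟪⟫-cong (quasi x₁ x₂ _ _ _) f≃g = ++-cong (f≃g x₁) (scale-cong (- 1#) (f≃g x₂))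

  ⟪⟫-++ : ∀ E (f g : Letter → Poly) → ⟪ E ⟫ (λ x → f x ++ g x) ≃ ⟪ E ⟫ f ++ ⟪ E ⟫ g
  ⟪⟫-++ (admissible x _)     f g = ≃-refl
  ⟪⟫-++ (quasi x₁ x₂ _ _ _) f g =
    ≃-trans (≡⇒≃ (≡.cong ((f x₁ ++ g x₁) ++_) (neg-++ (f x₂) (g x₂))))
            (interchange (f x₁) (g x₁) (neg (f x₂)) (neg (g x₂)))

  ⟪⟫-comm : ∀ E F (f : Letter → Letter → Poly) → ⟪ E ⟫ (λ x → ⟪ F ⟫ (f x)) ≃ ⟪ F ⟫ (λ z → ⟪ E ⟫ (λ x → f x z))
  ⟪⟫-comm (admissible _ _)     F                     f = ≃-refl
  ⟪⟫-comm (quasi _ _ _ _ _)   (admissible _ _)      f = ≃-refl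
  ⟪⟫-comm (quasi x₁ x₂ _ _ _) (quasi z₁ z₂ _ _ _) f =
    ≃-trans (≡⇒≃ (≡.cong ((f x₁ z₁ ⊖ f x₁ z₂) ++_) (neg-++ (f x₂ z₁) (neg (f x₂ z₂)))))
    (≃-trans (interchange (f x₁ z₁) (neg (f x₁ z₂)) (neg (f x₂ z₁)) (neg (neg (f x₂ z₂))))
             (≡⇒≃ (≡.cong ((f x₁ z₁ ⊖ f x₂ z₁) ++_) (≡.sym (neg-++ (f x₁ z₂) (neg (f x₂ z₂)))))))

  Y⁰-⟪⟫ : ∀ E {f} → (∀ x → Y⁰ (f x)) → Y⁰ (⟪ E ⟫ f)
  Y⁰-⟪⟫ (admissible x _)     f∈ = f∈ x
  Y⁰-⟪⟫ (quasi x₁ x₂ _ _ _) f∈ = Y⁰-⊖ (f∈ x₁) (f∈ x₂)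

  ⟪_,_⟫₂ : Ending → Ending → (Letter → Letter → Poly) → Poly
  ⟪ E , F ⟫₂ f = ⟪ E ⟫ (λ x → ⟪ F ⟫ (f x))

  ⟪,⟫₂-++ : ∀ E F (f g : Letter → Letter → Poly) →
            ⟪ E , F ⟫₂ (λ x z → f x z ++ g x z) ≃ ⟪ E , F ⟫₂ f ++ ⟪ E , F ⟫₂ g
  ⟪,⟫₂-++ E F f g = ≃-trans (⟪⟫-cong E (λ x → ⟪⟫-++ F (f x) (g x))) (⟪⟫-++ E _ _)

  data Basic : Set where
    empty : Basic
    _◂_   : Word → Ending → Basic

  ⟦_⟧ᴮ : Basic → Poly
  ⟦ empty ⟧ᴮ = (1# , []) ∷ []
  ⟦ w ◂ E ⟧ᴮ = ⟪ E ⟫ (λ x → (1# , w ▷ x) ∷ [])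

  basic : Gen → Basic
  basic (adm []      _)         = empty
  basic (adm (w ▷ x) x-adm)     = w ◂ admissible x x-adm
  basic (qadm w x₁ x₂ e₁ e₂ m≢) = w ◂ quasi x₁ x₂ e₁ e₂ m≢

  ⟦⟧≃⟦basic⟧ : ∀ g → ⟦ g ⟧ ≃ ⟦ basic g ⟧ᴮ
  ⟦⟧≃⟦basic⟧ (adm []      _)       = ≃-refl
  ⟦⟧≃⟦basic⟧ (adm (w ▷ x) _)       = ≃-refl
  ⟦⟧≃⟦basic⟧ (qadm w x₁ x₂ _ _ _) = ∷-cong _ refl (∷-cong _ (sym (*-identityʳ _)) ≃-refl)

  Y⁰-basic : ∀ b → Y⁰ ⟦ b ⟧ᴮ
  Y⁰-basic empty                       = Y⁰-⟦⟧ (adm [] _)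
  Y⁰-basic (w ◂ admissible x x-adm)    = Y⁰-⟦⟧ (adm (w ▷ x) x-adm)
  Y⁰-basic (w ◂ quasi x₁ x₂ e₁ e₂ m≢) =
    Y⁰-resp-≃ _ (≃-sym (⟦⟧≃⟦basic⟧ (qadm w x₁ x₂ e₁ e₂ m≢))) (Y⁰-⟦⟧ (qadm w x₁ x₂ e₁ e₂ m≢))

  module Products (ι : ℚ → Carrier) (μ : Carrier) where
    open Star ι μ

    appendL-admissible : ∀ P x → 2 ≤ k x → Y⁰ (appendL P x)
    appendL-admissible []            x _     = Y⁰-[]
    appendL-admissible ((a , w) ∷ P) x x-adm =
      Y⁰-∷-admissible a (w ▷ x) x-adm (appendL-admissible P x x-adm)

    appendL-quasi : ∀ P x₁ x₂ (e₁ : k x₁ ≡ 1) (e₂ : k x₂ ≡ 1) (m≢ : m x₁ ≢ m x₂) →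
                    Y⁰ (appendL P x₁ ⊖ appendL P x₂)
    appendL-quasi []            x₁ x₂ e₁ e₂ m≢ = Y⁰-[]
    appendL-quasi ((a , w) ∷ P) x₁ x₂ e₁ e₂ m≢ =
      Y⁰-resp-≃ _ (interchange ((a , w ▷ x₁) ∷ []) (appendL P x₁) ((- 1# * a , w ▷ x₂) ∷ []) (neg (appendL P x₂)))
        (Y⁰-++ (Y⁰-resp-≃ (scale a ⟦ qadm w x₁ x₂ e₁ e₂ m≢ ⟧)
                          (∷-cong _ (sym (*-identityʳ a)) (∷-cong _ (*-comm _ _) ≃-refl))
                          (Y⁰-scale a (Y⁰-⟦⟧ (qadm w x₁ x₂ e₁ e₂ m≢))))
               (appendL-quasi P x₁ x₂ e₁ e₂ m≢))

    Y⁰-⟪⟫-appendL : ∀ E P → Y⁰ (⟪ E ⟫ (appendL P))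
    Y⁰-⟪⟫-appendL (admissible x x-adm)     P = appendL-admissible P x x-adm
    Y⁰-⟪⟫-appendL (quasi x₁ x₂ e₁ e₂ m≢) P = appendL-quasi P x₁ x₂ e₁ e₂ m≢

    ⟪⟫-appendL : ∀ E (Q : Letter → Poly) z → ⟪ E ⟫ (λ x → appendL (Q x) z) ≡ appendL (⟪ E ⟫ Q) z
    ⟪⟫-appendL (admissible x _)     Q z = ≡.refl
    ⟪⟫-appendL (quasi x₁ x₂ _ _ _) Q z = ≡.sym (≡.trans (map-++ _ (Q x₁) (neg (Q x₂)))
      (≡.cong (appendL (Q x₁) z ++_) (≡.trans (≡.sym (map-∘ (Q x₂))) (map-∘ (Q x₂)))))

    coeff-∗ : ∀ p q w → coeff (p ∗ q) w ≈ ev (λ u → ev (λ v → coeff (u ∗w v) w) q) p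
    coeff-∗ []            q w = refl
    coeff-∗ ((a , u) ∷ p) q w =
      trans (coeff-concatMap-∷ _ (a , u) p w) (+-cong (monomial q) (coeff-∗ p q w))
      where
      monomial : ∀ q → coeff (((a , u) ∷ []) ∗ q) w ≈ a * ev (λ v → coeff (u ∗w v) w) q
      monomial []            = sym (zeroʳ a)
      monomial ((b , v) ∷ q) =
        trans (reflexive (≡.cong (λ r → coeff r w) (++-assoc (scale (a * b) (u ∗w v)) _ [])))
        (trans (coeff-++ (scale (a * b) (u ∗w v)) _ w)
        (trans (+-cong (trans (coeff-scale (a * b) (u ∗w v) w) (*-assoc a b _)) (monomial q))
               (sym (distribˡ a _ _))))

    ∗-cong : ∀ {p p′ q q′} → p ≃ p′ → q ≃ q′ → p ∗ q ≃ p′ ∗ q′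
    ∗-cong {p} {p′} {q} {q′} p≃p′ q≃q′ = coeffwise λ w → begin
      coeff (p ∗ q) w                                  ≈⟨ coeff-∗ p q w ⟩
      ev (λ u → ev (λ v → coeff (u ∗w v) w) q) p       ≈⟨ ev-resp-≃ _ p≃p′ ⟩
      ev (λ u → ev (λ v → coeff (u ∗w v) w) q) p′      ≈⟨ ev-cong (λ u → ev-resp-≃ _ q≃q′) p′ ⟩
      ev (λ u → ev (λ v → coeff (u ∗w v) w) q′) p′     ≈⟨ coeff-∗ p′ q′ w ⟨
      coeff (p′ ∗ q′) w                                ∎
      where open import Relation.Binary.Reasoning.Setoid setoid

    ∗-++ˡ : ∀ p₁ p₂ q → (p₁ ++ p₂) ∗ q ≃ p₁ ∗ q ++ p₂ ∗ q
    ∗-++ˡ p₁ p₂ q = coeffwise λ w →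
      trans (coeff-∗ (p₁ ++ p₂) q w) (trans (ev-++ _ p₁ p₂)
        (sym (trans (coeff-++ (p₁ ∗ q) (p₂ ∗ q) w) (+-cong (coeff-∗ p₁ q w) (coeff-∗ p₂ q w)))))

    ∗-++ʳ : ∀ p q₁ q₂ → p ∗ (q₁ ++ q₂) ≃ p ∗ q₁ ++ p ∗ q₂
    ∗-++ʳ p q₁ q₂ = coeffwise λ w →
      trans (coeff-∗ p (q₁ ++ q₂) w)
      (trans (ev-cong (λ u → ev-++ _ q₁ q₂) p)
      (trans (ev-+ _ _ p)
        (sym (trans (coeff-++ (p ∗ q₁) (p ∗ q₂) w) (+-cong (coeff-∗ p q₁ w) (coeff-∗ p q₂ w))))))

    ∗-scaleˡ : ∀ r p q → scale r p ∗ q ≃ scale r (p ∗ q)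
    ∗-scaleˡ r p q = coeffwise λ w →
      trans (coeff-∗ (scale r p) q w) (trans (ev-scale _ r p)
        (sym (trans (coeff-scale r (p ∗ q) w) (*-congˡ (coeff-∗ p q w)))))

    ∗-scaleʳ : ∀ r p q → p ∗ scale r q ≃ scale r (p ∗ q)
    ∗-scaleʳ r p q = coeffwise λ w →
      trans (coeff-∗ p (scale r q) w)
      (trans (ev-cong (λ u → ev-scale _ r q) p)
      (trans (ev-* _ r p)
        (sym (trans (coeff-scale r (p ∗ q) w) (*-congˡ (coeff-∗ p q w))))))

    ∗-zeroʳ : ∀ p → p ∗ [] ≃ []
    ∗-zeroʳ p = coeffwise λ w → trans (coeff-∗ p [] w) (ev-0 p)

    ∗-identityˡ : ∀ q → ((1# , []) ∷ []) ∗ q ≃ q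
    ∗-identityˡ q = coeffwise λ w →
      trans (coeff-∗ ((1# , []) ∷ []) q w) (trans (+-identityʳ _) (trans (*-identityˡ _) (ev-monomials q w)))

    ∗w-identityʳ : ∀ u → u ∗w [] ≡ (1# , u) ∷ []
    ∗w-identityʳ []      = ≡.refl
    ∗w-identityʳ (u ▷ x) = ≡.refl

    ∗-identityʳ : ∀ p → p ∗ ((1# , []) ∷ []) ≃ p
    ∗-identityʳ p = coeffwise λ w →
      trans (coeff-∗ p ((1# , []) ∷ []) w)
        (trans (ev-cong (λ u → trans (+-identityʳ _)
                              (trans (*-identityˡ _) (reflexive (≡.cong (λ r → coeff r w) (∗w-identityʳ u))))) p)
               (ev-monomials p w))

    ∗-monomials : ∀ u v → ((1# , u) ∷ []) ∗ ((1# , v) ∷ []) ≃ u ∗w v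
    ∗-monomials u v = coeffwise λ w →
      trans (reflexive (≡.cong (λ r → coeff r w) (≡.trans (++-identityʳ (scale (1# * 1#) (u ∗w v) ++ []))
                                                              (++-identityʳ (scale (1# * 1#) (u ∗w v))))))
            (trans (coeff-scale (1# * 1#) (u ∗w v) w) (trans (*-congʳ (*-identityˡ 1#)) (*-identityˡ _)))

    ⟪⟫-∗ˡ : ∀ E f q → ⟪ E ⟫ f ∗ q ≃ ⟪ E ⟫ (λ x → f x ∗ q)
    ⟪⟫-∗ˡ (admissible _ _)     f q = ≃-refl
    ⟪⟫-∗ˡ (quasi x₁ x₂ _ _ _) f q = ≃-trans (∗-++ˡ (f x₁) (neg (f x₂)) q) (++-cong ≃-refl (∗-scaleˡ (- 1#) (f x₂) q))

    ⟪⟫-∗ʳ : ∀ F p g → p ∗ ⟪ F ⟫ g ≃ ⟪ F ⟫ (λ z → p ∗ g z)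
    ⟪⟫-∗ʳ (admissible _ _)     p g = ≃-refl
    ⟪⟫-∗ʳ (quasi z₁ z₂ _ _ _) p g = ≃-trans (∗-++ʳ p (g z₁) (neg (g z₂))) (++-cong ≃-refl (∗-scaleʳ (- 1#) p (g z₂)))

    module Closure (ι-hom : RingMorphisms.IsRingHomomorphism
                              (CommutativeRing.rawRing +-*-commutativeRing) (CommutativeRing.rawRing R) ι) where
      open RingMorphisms.IsRingHomomorphism ι-hom using (*-homo; 1#-homo; -‿homo)

      Closing : LComb → Set (c ⊔ ℓ)
      Closing L = ∀ a w → Y⁰ (μmul ((a , w) ∷ []) L)

      Y⁰-μmul : ∀ {L} → Closing L → ∀ P → Y⁰ (μmul P L)
      Y⁰-μmul L-closing []            = Y⁰-[]
      Y⁰-μmul L-closing ((a , w) ∷ P) =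
        Y⁰-resp-≃ _ (≡⇒≃ (≡.cong (_++ μmul P _) (≡.sym (++-identityʳ _))))
                  (Y⁰-++ (L-closing a w) (Y⁰-μmul L-closing P))

      μmul-monomial-++ : ∀ a w L₁ L₂ →
        μmul ((a , w) ∷ []) (L₁ ++ L₂) ≡ μmul ((a , w) ∷ []) L₁ ++ μmul ((a , w) ∷ []) L₂
      μmul-monomial-++ a w []            L₂ = ≡.refl
      μmul-monomial-++ a w ((q , z) ∷ L₁) L₂ = ≡.cong (_ ∷_) (μmul-monomial-++ a w L₁ L₂)

      Closing-++ : ∀ {L₁ L₂} → Closing L₁ → Closing L₂ → Closing (L₁ ++ L₂)
      Closing-++ {L₁} {L₂} L₁-closing L₂-closing a w =
        Y⁰-resp-≃ _ (≡⇒≃ (μmul-monomial-++ a w L₁ L₂)) (Y⁰-++ (L₁-closing a w) (L₂-closing a w))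

      μmul-monomial-scaleℚ : ∀ a w r L → μmul ((a , w) ∷ []) (scaleℚ r L) ≃ scale (ι r) (μmul ((a , w) ∷ []) L)
      μmul-monomial-scaleℚ a w r []            = ≃-refl
      μmul-monomial-scaleℚ a w r ((q , z) ∷ L) = ∷-cong (w ▷ z) coefficient (μmul-monomial-scaleℚ a w r L)
        where
        open CommutativeSemigroupProperties (CommutativeMonoid.commutativeSemigroup *-commutativeMonoid)
          using (x∙yz≈y∙xz)
        coefficient : - (μ * (a * ι (r *ℚ q))) ≈ ι r * - (μ * (a * ι q))
        coefficient = trans (-‿cong (trans (*-congˡ (trans (*-congˡ (*-homo r q)) (x∙yz≈y∙xz a (ι r) (ι q))))
                                            (x∙yz≈y∙xz μ (ι r) (a * ι q))))
                            (-‿distribʳ-* (ι r) _)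

      Closing-scaleℚ : ∀ r {L} → Closing L → Closing (scaleℚ r L)
      Closing-scaleℚ r {L} L-closing a w =
        Y⁰-resp-≃ _ (μmul-monomial-scaleℚ a w r L) (Y⁰-scale (ι r) (L-closing a w))

      Closing-admissible : ∀ q x → 2 ≤ k x → Closing ((q , x) ∷ [])
      Closing-admissible q x x-adm a w = Y⁰-∷-admissible _ (w ▷ x) x-adm Y⁰-[]

      Closing-quasi : ∀ x₁ x₂ (e₁ : k x₁ ≡ 1) (e₂ : k x₂ ≡ 1) (m≢ : m x₁ ≢ m x₂) r → ι r ≈ - 1# →
                      Closing ((1ℚ , x₁) ∷ (r , x₂) ∷ [])
      Closing-quasi x₁ x₂ e₁ e₂ m≢ r ιr≈-1 a w =
        Y⁰-resp-≃ (scale (- (μ * a)) ⟦ qadm w x₁ x₂ e₁ e₂ m≢ ⟧)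
          (∷-cong (w ▷ x₁) (trans (pull-μa (ι 1ℚ)) (*-congˡ 1#-homo))
          (∷-cong (w ▷ x₂) (trans (pull-μa (ι r)) (*-congˡ ιr≈-1)) ≃-refl))
          (Y⁰-scale (- (μ * a)) (Y⁰-⟦⟧ (qadm w x₁ x₂ e₁ e₂ m≢)))
        where
        pull-μa : ∀ s → - (μ * (a * s)) ≈ - (μ * a) * s
        pull-μa s = trans (-‿cong (sym (*-assoc μ a s))) (-‿distribˡ-* (μ * a) s)

      ι[-1*1]≈-1 : ι ((-ℚ 1ℚ) *ℚ 1ℚ) ≈ - 1#
      ι[-1*1]≈-1 = trans (*-homo (-ℚ 1ℚ) 1ℚ)
        (trans (*-cong (trans (-‿homo 1ℚ) (-‿cong 1#-homo)) 1#-homo) (*-identityʳ _))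

      -- Letters of degree 1 only arise in pf 1 1, as the difference y_{1,a} − y_{1,b}.
      Closing-pf : ∀ {a b} .(pa : 0ℚ <ℚ a) .(pb : 0ℚ <ℚ b) → a ≢ b → ∀ p q →
                   Closing (pf a b pa pb (suc p) (suc q))
      Closing-pf {a} {b} pa pb a≢b zero zero =
        Closing-scaleℚ (inv (b -ℚ a))
          (Closing-quasi (y 1 a (s≤s z≤n) pa) (y 1 b (s≤s z≤n) pb) ≡.refl ≡.refl a≢b ((-ℚ 1ℚ) *ℚ 1ℚ) ι[-1*1]≈-1)
      Closing-pf {a} {b} pa pb a≢b (suc p) zero =
        Closing-scaleℚ (inv (b -ℚ a))
          (Closing-++ (Closing-admissible 1ℚ _ (s≤s (s≤s z≤n))) (Closing-scaleℚ (-ℚ 1ℚ) (Closing-pf pa pb a≢b p zero)))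
      Closing-pf {a} {b} pa pb a≢b zero (suc q) =
        Closing-scaleℚ (inv (b -ℚ a))
          (Closing-++ (Closing-pf pa pb a≢b zero q) (Closing-scaleℚ (-ℚ 1ℚ) (Closing-admissible 1ℚ _ (s≤s (s≤s z≤n)))))
      Closing-pf {a} {b} pa pb a≢b (suc p) (suc q) =
        Closing-scaleℚ (inv (b -ℚ a))
          (Closing-++ (Closing-pf pa pb a≢b (suc p) q) (Closing-scaleℚ (-ℚ 1ℚ) (Closing-pf pa pb a≢b p (suc q))))

      Closing-⊙ : ∀ x z → Closing (x ⊙ z)
      Closing-⊙ (y zero _ k≥1 _) _ = ⊥-elim (n≮0 k≥1)
      Closing-⊙ (y (suc _) _ _ _) (y zero _ k≥1 _) = ⊥-elim (n≮0 k≥1)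
      Closing-⊙ (y (suc k₁) m₁ _ m₁>0) (y (suc k₂) m₂ _ m₂>0) with m₁ ≟ℚ m₂
      ... | yes _    = Closing-admissible 1ℚ _ (s≤s (≤-trans (s≤s z≤n) (m≤n+m (suc k₂) k₁)))
      ... | no m₁≢m₂ = Closing-pf m₁>0 m₂>0 m₁≢m₂ k₁ k₂

      Y⁰-⟪,⟫₂-∗w : ∀ E F u v → Y⁰ (⟪ E , F ⟫₂ (λ x z → (u ▷ x) ∗w (v ▷ z)))
      Y⁰-⟪,⟫₂-∗w E F u v =
        Y⁰-resp-≃ _ (≃-trans (⟪,⟫₂-++ E F A (λ x z → B x z ++ C x z)) (++-cong ≃-refl (⟪,⟫₂-++ E F B C)))
          (Y⁰-++ A-part (Y⁰-++ B-part C-part))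
        where
        A B C : Letter → Letter → Poly
        A x z = appendL (u ∗w (v ▷ z)) x
        B x z = appendL ((u ▷ x) ∗w v) z
        C x z = μmul (u ∗w v) (x ⊙ z)

        A-part : Y⁰ (⟪ E , F ⟫₂ A)
        A-part = Y⁰-resp-≃ _ (⟪⟫-cong E λ x → ≡⇒≃ (⟪⟫-appendL F (λ z → u ∗w (v ▷ z)) x))
                             (Y⁰-⟪⟫-appendL E _)

        B-part : Y⁰ (⟪ E , F ⟫₂ B)
        B-part = Y⁰-resp-≃ _ (≃-trans (⟪⟫-comm E F B) (⟪⟫-cong F λ z → ≡⇒≃ (⟪⟫-appendL E (λ x → (u ▷ x) ∗w v) z)))
                             (Y⁰-⟪⟫-appendL F _)

        C-part : Y⁰ (⟪ E , F ⟫₂ C)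
        C-part = Y⁰-⟪⟫ E λ x → Y⁰-⟪⟫ F λ z → Y⁰-μmul (Closing-⊙ x z) (u ∗w v)

      Y⁰-basic-∗ : ∀ b b′ → Y⁰ (⟦ b ⟧ᴮ ∗ ⟦ b′ ⟧ᴮ)
      Y⁰-basic-∗ empty   b′      = Y⁰-resp-≃ _ (∗-identityˡ ⟦ b′ ⟧ᴮ) (Y⁰-basic b′)
      Y⁰-basic-∗ (u ◂ E) empty   = Y⁰-resp-≃ _ (∗-identityʳ ⟦ u ◂ E ⟧ᴮ) (Y⁰-basic (u ◂ E))
      Y⁰-basic-∗ (u ◂ E) (v ◂ F) = Y⁰-resp-≃ _ expand (Y⁰-⟪,⟫₂-∗w E F u v)
        where
        expand : ⟦ u ◂ E ⟧ᴮ ∗ ⟦ v ◂ F ⟧ᴮ ≃ ⟪ E , F ⟫₂ (λ x z → (u ▷ x) ∗w (v ▷ z))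
        expand = ≃-trans (⟪⟫-∗ˡ E (λ x → (1# , u ▷ x) ∷ []) ⟦ v ◂ F ⟧ᴮ) (⟪⟫-cong E λ x →
                   ≃-trans (⟪⟫-∗ʳ F ((1# , u ▷ x) ∷ []) (λ z → (1# , v ▷ z) ∷ []))
                           (⟪⟫-cong F λ z → ∗-monomials (u ▷ x) (v ▷ z)))

      Y⁰-⟦⟧-∗ : ∀ g h → Y⁰ (⟦ g ⟧ ∗ ⟦ h ⟧)
      Y⁰-⟦⟧-∗ g h = Y⁰-resp-≃ _ (∗-cong (⟦⟧≃⟦basic⟧ g) (⟦⟧≃⟦basic⟧ h)) (Y⁰-basic-∗ (basic g) (basic h))

      Y⁰-⟦⟧-∗-lin : ∀ g hs → Y⁰ (⟦ g ⟧ ∗ lin hs)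
      Y⁰-⟦⟧-∗-lin g []             = Y⁰-resp-≃ [] (∗-zeroʳ ⟦ g ⟧) Y⁰-[]
      Y⁰-⟦⟧-∗-lin g ((s , h) ∷ hs) =
        Y⁰-resp-≃ _ (≃-trans (∗-++ʳ ⟦ g ⟧ (scale s ⟦ h ⟧) (lin hs)) (++-cong (∗-scaleʳ s ⟦ g ⟧ ⟦ h ⟧) ≃-refl))
          (Y⁰-++ (Y⁰-scale s (Y⁰-⟦⟧-∗ g h)) (Y⁰-⟦⟧-∗-lin g hs))

      Y⁰-lin-∗-lin : ∀ gs hs → Y⁰ (lin gs ∗ lin hs)
      Y⁰-lin-∗-lin []             hs = Y⁰-[]
      Y⁰-lin-∗-lin ((r , g) ∷ gs) hs =
        Y⁰-resp-≃ _ (≃-trans (∗-++ˡ (scale r ⟦ g ⟧) (lin gs) (lin hs)) (++-cong (∗-scaleˡ r ⟦ g ⟧ (lin hs)) ≃-refl))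
          (Y⁰-++ (Y⁰-scale r (Y⁰-⟦⟧-∗-lin g hs)) (Y⁰-lin-∗-lin gs hs))

      ∗-closed : ∀ p q → InY⁰ p → InY⁰ q → InY⁰ (p ∗ q)
      ∗-closed p q (gs , p≋) (hs , q≋) =
        membership (Y⁰-resp-≃ _ (∗-cong {p} {lin gs} {q} {lin hs} (coeffwise p≋) (coeffwise q≋)) (Y⁰-lin-∗-lin gs hs))

proposition3p10 : {c ℓ : Level} (R : CommutativeRing c ℓ)
    (ι : ℚ → CommutativeRing.Carrier R)
    → RingMorphisms.IsRingHomomorphism (CommutativeRing.rawRing +-*-commutativeRing) (CommutativeRing.rawRing R) ι
    → (μ : CommutativeRing.Carrier R)
    → (p q : FreeModule.Poly R)
    → FreeModule.InY⁰ R p → FreeModule.InY⁰ R q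
    → FreeModule.InY⁰ R (FreeModule.Star._∗_ R ι μ p q)
proposition3p10 R ι ι-hom μ = Polynomials.Products.Closure.∗-closed R ι μ ι-hom
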